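{- Let $S$ be a set. The following are equivalent: (1) every saturated basic topology on $S$ is reduced; (2) $T^{SR}=T^S$ for every basic topology $T$ on $S$; (3) $\mathbb{A}(\mathbb{J}(\mathcal{A}))=\mathcal{A}$ for every saturation $\mathcal{A}$ on $S$; (4) $\mathbb{A}$ is surjective, i.e. every saturation on $S$ is of the form $\mathbb{A}(\mathcal{J})$ for some reduction $\mathcal{J}$ on $S$; (5) $\mathbb{J}$ is injective, i.e. $\mathbb{J}(\mathcal{A})=\mathbb{J}(\mathcal{A}')$ implies $\mathcal{A}=\mathcal{A}'$ for saturations $\mathcal{A},\mathcal{A}'$ on $S$. Dually, the following are equivalent: (1') every reduced basic topology on $S$ is saturated; (2') $T^{RS}=T^R$ for every basic topology $T$ on $S$; (3') $\mathbb{J}(\mathbb{A}(\mathcal{J}))=\mathcal{J}$ for every reduction $\mathcal{J}$ on $S$; (4') $\mathbb{J}$ is surjective, i.e. every reduction on $S$ is of the form $\mathbb{J}(\mathcal{A})$ for some saturation $\mathcal{A}$; (5') $\mathbb{A}$ is injective, i.e. $\mathbb{A}(\mathcal{J})=\mathbb{A}(\mathcal{J}')$ implies $\mathcal{J}=\mathcal{J}'$.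
   Context: All reasoning is intuitionistic (no law of excluded middle); impredicative constructions allowed. An operator on $S$ is a map $\mathrm{Pow}(S)\to\mathrm{Pow}(S)$, ordered pointwise by inclusion. For $U,V\subseteq S$, $U\between V$ means there exists $a\in U\cap V$. $\mathcal{O}\triangleleft\mathcal{O}'$ means: for all $U,V\subseteq S$, $\mathcal{O}(U)\between\mathcal{O}'(V)$ implies $U\between\mathcal{O}'(V)$. A saturation is a monotone idempotent operator $\mathcal{A}$ with $U\subseteq\mathcal{A}(U)$ for all $U$; a reduction is a monotone idempotent operator $\mathcal{J}$ with $\mathcal{J}(U)\subseteq U$ for all $U$. For a reduction $\mathcal{J}$, $\mathbb{A}(\mathcal{J})$ is the greatest saturation $\mathcal{A}$ with $\mathcal{A}\triangleleft\mathcal{J}$; for a saturation $\mathcal{A}$, $\mathbb{J}(\mathcal{A})$ is the greatest reduction $\mathcal{J}$ with $\mathcal{A}\triangleleft\mathcal{J}$ (both exist). A basic topology on $S$ is a pair $[\mathcal{A},\mathcal{J}]$ with $\mathcal{A}$ a saturation, $\mathcal{J}$ a reduction on $S$, and $\mathcal{A}\triangleleft\mathcal{J}$. It is called reduced if it is of the form $[\mathbb{A}(\mathcal{J}),\mathcal{J}]$ for some reduction $\mathcal{J}$, and saturated if it is of the form $[\mathcal{A},\mathbb{J}(\mathcal{A})]$ for some saturation $\mathcal{A}$. For $T=[\mathcal{A},\mathcal{J}]$ define $T^R=[\mathbb{A}(\mathcal{J}),\mathcal{J}]$ and $T^S=[\mathcal{A},\mathbb{J}(\mathcal{A})]$; $T^{SR}$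 means $(T^S)^R$ and $T^{RS}$ means $(T^R)^S$. -}

module Defs where

open import Level using (Level; suc; _⊔_)
open import Data.Product using (_×_; Σ; ∃; _,_)
open import Function.Bundles using (_⇔_)
open import Relation.Unary using (Pred; _⊆_; _≐_; _≬_)

Pow : ∀ {ℓ} → Set ℓ → Set (suc ℓ)
Pow {ℓ} S = Pred S ℓ

Op : ∀ {ℓ} → Set ℓ → Set (suc ℓ)
Op S = Pow S → Pow S

module _ {ℓ : Level} {S : Set ℓ} where

  _≤ₒ_ : Op S → Op S → Set (suc ℓ)
  O ≤ₒ O' = ∀ U → O U ⊆ O' U

  _≈ₒ_ : Op S → Op S → Set (suc ℓ)
  O ≈ₒ O' = ∀ U → O U ≐ O' U

  Monotone : Op S → Set (suc ℓ)
  Monotone O = ∀ {U V} → U ⊆ V → O U ⊆ O V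

  Idempotent : Op S → Set (suc ℓ)
  Idempotent O = ∀ U → O (O U) ≐ O U

  IsSaturation : Op S → Set (suc ℓ)
  IsSaturation A = Monotone A × Idempotent A × (∀ U → U ⊆ A U)

  IsReduction : Op S → Set (suc ℓ)
  IsReduction J = Monotone J × Idempotent J × (∀ U → J U ⊆ U)

  _◁_ : Op S → Op S → Set (suc ℓ)
  O ◁ O' = ∀ U V → O U ≬ O' V → U ≬ O' V

  IsGreatestSat : Op S → Op S → Set (suc ℓ)
  IsGreatestSat J A = IsSaturation A × A ◁ J
                      × (∀ A' → IsSaturation A' → A' ◁ J → A' ≤ₒ A)

  IsGreatestRed : Op S → Op S → Set (suc ℓ)
  IsGreatestRed A J = IsReduction J × A ◁ J
                      × (∀ J' → IsReduction J' → A ◁ J' → J' ≤ₒ J)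

  -- 𝔸 : reductions → saturations, 𝕁 : saturations → reductions
  -- (given as functions on operators, specified on the relevant domain)
  IsBigA : (Op S → Op S) → Set (suc ℓ)
  IsBigA 𝔸 = ∀ J → IsReduction J → IsGreatestSat J (𝔸 J)

  IsBigJ : (Op S → Op S) → Set (suc ℓ)
  IsBigJ 𝕁 = ∀ A → IsSaturation A → IsGreatestRed A (𝕁 A)

  record BasicTopology : Set (suc ℓ) where
    constructor [_,_]
    field
      sat : Op S
      red : Op S
      isSat : IsSaturation sat
      isRed : IsReduction red
      sat◁red : sat ◁ red

  open BasicTopology public

  _≈ᵀ_ : BasicTopology → BasicTopology → Set (suc ℓ)
  T ≈ᵀ T' = (sat T ≈ₒ sat T') × (red T ≈ₒ red T')

  module Topologies (𝔸 𝕁 : Op S → Op S) where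

    Reduced : BasicTopology → Set (suc ℓ)
    Reduced T = Σ (Op S) λ J → IsReduction J × (sat T ≈ₒ 𝔸 J) × (red T ≈ₒ J)

    Saturated : BasicTopology → Set (suc ℓ)
    Saturated T = Σ (Op S) λ A → IsSaturation A × (sat T ≈ₒ A) × (red T ≈ₒ 𝕁 A)

    OpPair : Set (suc ℓ)
    OpPair = Op S × Op S

    ⌜_⌝ : BasicTopology → OpPair
    ⌜ T ⌝ = sat T , red T

    _ˢ : OpPair → OpPair
    (A , J) ˢ = A , 𝕁 A

    _ʳ : OpPair → OpPair
    (A , J) ʳ = 𝔸 J , J

    _≈ₚ_ : OpPair → OpPair → Set (suc ℓ)
    (A , J) ≈ₚ (A' , J') = (A ≈ₒ A') × (J ≈ₒ J')

TFAE5 : ∀ {a} → (P₁ P₂ P₃ P₄ P₅ : Set a) → Set a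
TFAE5 P₁ P₂ P₃ P₄ P₅ = (P₁ ⇔ P₂) × (P₁ ⇔ P₃) × (P₁ ⇔ P₄) × (P₁ ⇔ P₅)

-- Under IsBigA and IsBigJ, A ◁ J is equivalent both to A ≤ 𝔸 J and to J ≤ 𝕁 A, so 𝔸 and 𝕁
-- form an antitone Galois connection between saturations and reductions. For any antitone
-- Galois connection F ⊣ G, the conditions G ∘ F = id, G surjective and F injective are
-- equivalent, because F ∘ G ∘ F = F. Conditions (1) and (2) are reformulations of G ∘ F = id
-- in terms of basic topologies; the dual list is the same argument with the roles swapped.
module Submission where

open import Defs
open import Level using (Level; suc)
open import Data.Product using (_×_; Σ; _,_; proj₁; proj₂)
open import Function.Base using (_∘_)
open import Function.Bundles using (_⇔_; mk⇔; Equivalence)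
open import Function.Construct.Symmetry using (⇔-sym)
open import Function.Construct.Composition using (_⇔-∘_)
open import Relation.Unary using (_⊆_)
open import Relation.Unary.Properties using (≐-refl; ≐-sym; ≐-trans)

module _ {ℓ : Level} {S : Set ℓ} where

  private variable
    O O′ O″ A A′ J J′ : Op S

  ≤ₒ-refl : O ≤ₒ O
  ≤ₒ-refl U x∈OU = x∈OU

  ≤ₒ-trans : O ≤ₒ O′ → O′ ≤ₒ O″ → O ≤ₒ O″
  ≤ₒ-trans p q U x∈OU = q U (p U x∈OU)

  ≤ₒ-antisym : O ≤ₒ O′ → O′ ≤ₒ O → O ≈ₒ O′
  ≤ₒ-antisym p q U = p U , q U

  ≈ₒ⇒≤ₒ : O ≈ₒ O′ → O ≤ₒ O′
  ≈ₒ⇒≤ₒ e U = proj₁ (e U)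

  ≈ₒ-refl : O ≈ₒ O
  ≈ₒ-refl U = ≐-refl

  ≈ₒ-sym : O ≈ₒ O′ → O′ ≈ₒ O
  ≈ₒ-sym e U = ≐-sym (e U)

  ≈ₒ-trans : O ≈ₒ O′ → O′ ≈ₒ O″ → O ≈ₒ O″
  ≈ₒ-trans e f U = ≐-trans (e U) (f U)

  ◁-antitoneˡ : A ≤ₒ A′ → A′ ◁ J → A ◁ J
  ◁-antitoneˡ A≤A′ A′◁J U V (x , x∈AU , x∈JV) = A′◁J U V (x , A≤A′ U x∈AU , x∈JV)

  -- Apply A ◁ J′ to the set J V, using J V = J (J V) ⊆ J′ (J V) ⊆ J V.
  ◁-antitoneʳ : Idempotent J → (∀ U → J′ U ⊆ U) → J ≤ₒ J′ → A ◁ J′ → A ◁ J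
  ◁-antitoneʳ {J = J} J-idem J′-deflationary J≤J′ A◁J′ U V (x , x∈AU , x∈JV) =
    let y , y∈U , y∈J′JV = A◁J′ U (J V) (x , x∈AU , J≤J′ (J V) (proj₂ (J-idem V) x∈JV))
    in  y , y∈U , J′-deflationary (J V) y∈J′JV

module AntitoneGaloisConnection
  {ℓ : Level} {S : Set ℓ} {P Q : Op S → Set (suc ℓ)} {F G : Op S → Op S}
  (F-closed : ∀ {a} → P a → Q (F a)) (G-closed : ∀ {b} → Q b → P (G b))
  (galois : ∀ {a b} → P a → Q b → (a ≤ₒ G b) ⇔ (b ≤ₒ F a))
  where

  private variable
    a a′ b b′ : Op S

  unit : P a → a ≤ₒ G (F a)
  unit pa = Equivalence.from (galois pa (F-closed pa)) ≤ₒ-refl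

  counit : Q b → b ≤ₒ F (G b)
  counit qb = Equivalence.to (galois (G-closed qb) qb) ≤ₒ-refl

  F-antitone : P a → P a′ → a ≤ₒ a′ → F a′ ≤ₒ F a
  F-antitone pa pa′ a≤a′ = Equivalence.to (galois pa (F-closed pa′)) (≤ₒ-trans a≤a′ (unit pa′))

  G-antitone : Q b → Q b′ → b ≤ₒ b′ → G b′ ≤ₒ G b
  G-antitone qb qb′ b≤b′ = Equivalence.from (galois (G-closed qb′) qb) (≤ₒ-trans b≤b′ (counit qb′))

  G-cong : Q b → Q b′ → b ≈ₒ b′ → G b ≈ₒ G b′
  G-cong qb qb′ b≈b′ =
    ≤ₒ-antisym (G-antitone qb′ qb (≈ₒ⇒≤ₒ (≈ₒ-sym b≈b′))) (G-antitone qb qb′ (≈ₒ⇒≤ₒ b≈b′))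

  F∘G∘F≈F : P a → F (G (F a)) ≈ₒ F a
  F∘G∘F≈F pa = ≤ₒ-antisym (F-antitone pa (G-closed (F-closed pa)) (unit pa)) (counit (F-closed pa))

  G∘F≈id : Set (suc ℓ)
  G∘F≈id = ∀ a → P a → G (F a) ≈ₒ a

  G-surjective : Set (suc ℓ)
  G-surjective = ∀ a → P a → Σ (Op S) λ b → Q b × (G b ≈ₒ a)

  F-injective : Set (suc ℓ)
  F-injective = ∀ a a′ → P a → P a′ → F a ≈ₒ F a′ → a ≈ₒ a′

  G∘F≈id⇒G-surjective : G∘F≈id → G-surjective
  G∘F≈id⇒G-surjective GF≈id a pa = F a , F-closed pa , GF≈id a pa

  -- If a ≈ G b then b ≤ F a, hence G (F a) ≤ G b ≈ a.
  G-surjective⇒G∘F≈id : G-surjective → G∘F≈id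
  G-surjective⇒G∘F≈id G-onto a pa =
    let b , qb , Gb≈a = G-onto a pa
        b≤Fa = Equivalence.to (galois pa qb) (≈ₒ⇒≤ₒ (≈ₒ-sym Gb≈a))
    in  ≤ₒ-antisym (≤ₒ-trans (G-antitone qb (F-closed pa) b≤Fa) (≈ₒ⇒≤ₒ Gb≈a)) (unit pa)

  G∘F≈id⇒F-injective : G∘F≈id → F-injective
  G∘F≈id⇒F-injective GF≈id a a′ pa pa′ Fa≈Fa′ =
    ≈ₒ-trans (≈ₒ-sym (GF≈id a pa))
      (≈ₒ-trans (G-cong (F-closed pa) (F-closed pa′) Fa≈Fa′) (GF≈id a′ pa′))

  F-injective⇒G∘F≈id : F-injective → G∘F≈id
  F-injective⇒G∘F≈id F-inj a pa = F-inj (G (F a)) a (G-closed (F-closed pa)) pa (F∘G∘F≈F pa)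

module BasicTopologyGalois {ℓ : Level} {S : Set ℓ} {𝔸 𝕁 : Op S → Op S}
  (isBigA : IsBigA 𝔸) (isBigJ : IsBigJ 𝕁) where

  open Topologies 𝔸 𝕁

  private variable
    A J : Op S

  𝔸-isSaturation : IsReduction J → IsSaturation (𝔸 J)
  𝔸-isSaturation r = proj₁ (isBigA _ r)

  𝔸J◁J : IsReduction J → 𝔸 J ◁ J
  𝔸J◁J r = proj₁ (proj₂ (isBigA _ r))

  𝕁-isReduction : IsSaturation A → IsReduction (𝕁 A)
  𝕁-isReduction s = proj₁ (isBigJ _ s)

  A◁𝕁A : IsSaturation A → A ◁ 𝕁 A
  A◁𝕁A s = proj₁ (proj₂ (isBigJ _ s))

  ◁⇔≤𝔸 : IsSaturation A → IsReduction J → A ◁ J ⇔ A ≤ₒ 𝔸 J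
  ◁⇔≤𝔸 s r = mk⇔ (proj₂ (proj₂ (isBigA _ r)) _ s) (λ A≤𝔸J → ◁-antitoneˡ A≤𝔸J (𝔸J◁J r))

  ◁⇔≤𝕁 : IsSaturation A → IsReduction J → A ◁ J ⇔ J ≤ₒ 𝕁 A
  ◁⇔≤𝕁 s r@(_ , J-idem , _) = mk⇔ (proj₂ (proj₂ (isBigJ _ s)) _ r)
    (λ J≤𝕁A → ◁-antitoneʳ J-idem (proj₂ (proj₂ (𝕁-isReduction s))) J≤𝕁A (A◁𝕁A s))

  ≤𝔸⇔≤𝕁 : IsSaturation A → IsReduction J → (A ≤ₒ 𝔸 J) ⇔ (J ≤ₒ 𝕁 A)
  ≤𝔸⇔≤𝕁 s r = ◁⇔≤𝕁 s r ⇔-∘ ⇔-sym (◁⇔≤𝔸 s r)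

  module Sat = AntitoneGaloisConnection 𝕁-isReduction 𝔸-isSaturation ≤𝔸⇔≤𝕁
  module Red = AntitoneGaloisConnection 𝔸-isSaturation 𝕁-isReduction (λ r s → ⇔-sym (≤𝔸⇔≤𝕁 s r))

  saturatedTopology : IsSaturation A → BasicTopology
  saturatedTopology {A} s = [ A , 𝕁 A ] s (𝕁-isReduction s) (A◁𝕁A s)

  reducedTopology : IsReduction J → BasicTopology
  reducedTopology {J} r = [ 𝔸 J , J ] (𝔸-isSaturation r) r (𝔸J◁J r)

  saturated⇒reduced⇒𝔸-surjective : (∀ T → Saturated T → Reduced T) → Sat.G-surjective
  saturated⇒reduced⇒𝔸-surjective sat⇒red A s =
    let J , r , A≈𝔸J , _ = sat⇒red (saturatedTopology s) (A , s , ≈ₒ-refl , ≈ₒ-refl)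
    in  J , r , ≈ₒ-sym A≈𝔸J

  saturated⇒reduced⇒𝔸∘𝕁≈id : (∀ T → Saturated T → Reduced T) → Sat.G∘F≈id
  saturated⇒reduced⇒𝔸∘𝕁≈id = Sat.G-surjective⇒G∘F≈id ∘ saturated⇒reduced⇒𝔸-surjective

  𝔸∘𝕁≈id⇒saturated⇒reduced : Sat.G∘F≈id → ∀ T → Saturated T → Reduced T
  𝔸∘𝕁≈id⇒saturated⇒reduced 𝔸𝕁≈id T (A , s , T≈A , redT≈𝕁A) =
    𝕁 A , 𝕁-isReduction s , ≈ₒ-trans T≈A (≈ₒ-sym (𝔸𝕁≈id A s)) , redT≈𝕁A

  ˢʳ≈ˢ⇒𝔸∘𝕁≈id : (∀ T → (((⌜ T ⌝) ˢ) ʳ) ≈ₚ ((⌜ T ⌝) ˢ)) → Sat.G∘F≈id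
  ˢʳ≈ˢ⇒𝔸∘𝕁≈id SR≈S A s = proj₁ (SR≈S (saturatedTopology s))

  𝔸∘𝕁≈id⇒ˢʳ≈ˢ : Sat.G∘F≈id → ∀ T → (((⌜ T ⌝) ˢ) ʳ) ≈ₚ ((⌜ T ⌝) ˢ)
  𝔸∘𝕁≈id⇒ˢʳ≈ˢ 𝔸𝕁≈id T = 𝔸𝕁≈id (sat T) (isSat T) , ≈ₒ-refl

  reduced⇒saturated⇒𝕁-surjective : (∀ T → Reduced T → Saturated T) → Red.G-surjective
  reduced⇒saturated⇒𝕁-surjective red⇒sat J r =
    let A , s , _ , J≈𝕁A = red⇒sat (reducedTopology r) (J , r , ≈ₒ-refl , ≈ₒ-refl)
    in  A , s , ≈ₒ-sym J≈𝕁A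

  reduced⇒saturated⇒𝕁∘𝔸≈id : (∀ T → Reduced T → Saturated T) → Red.G∘F≈id
  reduced⇒saturated⇒𝕁∘𝔸≈id = Red.G-surjective⇒G∘F≈id ∘ reduced⇒saturated⇒𝕁-surjective

  𝕁∘𝔸≈id⇒reduced⇒saturated : Red.G∘F≈id → ∀ T → Reduced T → Saturated T
  𝕁∘𝔸≈id⇒reduced⇒saturated 𝕁𝔸≈id T (J , r , satT≈𝔸J , T≈J) =
    𝔸 J , 𝔸-isSaturation r , satT≈𝔸J , ≈ₒ-trans T≈J (≈ₒ-sym (𝕁𝔸≈id J r))

  ʳˢ≈ʳ⇒𝕁∘𝔸≈id : (∀ T → (((⌜ T ⌝) ʳ) ˢ) ≈ₚ ((⌜ T ⌝) ʳ)) → Red.G∘F≈id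
  ʳˢ≈ʳ⇒𝕁∘𝔸≈id RS≈R J r = proj₂ (RS≈R (reducedTopology r))

  𝕁∘𝔸≈id⇒ʳˢ≈ʳ : Red.G∘F≈id → ∀ T → (((⌜ T ⌝) ʳ) ˢ) ≈ₚ ((⌜ T ⌝) ʳ)
  𝕁∘𝔸≈id⇒ʳˢ≈ʳ 𝕁𝔸≈id T = ≈ₒ-refl , 𝕁𝔸≈id (red T) (isRed T)

proposition4p1 : {ℓ : Level} (S : Set ℓ) (𝔸 𝕁 : Op S → Op S) → IsBigA 𝔸 → IsBigJ 𝕁 →
    let open Topologies 𝔸 𝕁 in
    TFAE5
      (∀ T → Saturated T → Reduced T)
      (∀ T → (((⌜ T ⌝) ˢ) ʳ) ≈ₚ ((⌜ T ⌝) ˢ))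
      (∀ A → IsSaturation A → 𝔸 (𝕁 A) ≈ₒ A)
      (∀ A → IsSaturation A → Σ (Op S) λ J → IsReduction J × (𝔸 J ≈ₒ A))
      (∀ A A′ → IsSaturation A → IsSaturation A′ → 𝕁 A ≈ₒ 𝕁 A′ → A ≈ₒ A′)
    ×
    TFAE5
      (∀ T → Reduced T → Saturated T)
      (∀ T → (((⌜ T ⌝) ʳ) ˢ) ≈ₚ ((⌜ T ⌝) ʳ))
      (∀ J → IsReduction J → 𝕁 (𝔸 J) ≈ₒ J)
      (∀ J → IsReduction J → Σ (Op S) λ A → IsSaturation A × (𝕁 A ≈ₒ J))
      (∀ J J′ → IsReduction J → IsReduction J′ → 𝔸 J ≈ₒ 𝔸 J′ → J ≈ₒ J′)
proposition4p1 S 𝔸 𝕁 isBigA isBigJ =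
    ( mk⇔ (𝔸∘𝕁≈id⇒ˢʳ≈ˢ ∘ saturated⇒reduced⇒𝔸∘𝕁≈id) (𝔸∘𝕁≈id⇒saturated⇒reduced ∘ ˢʳ≈ˢ⇒𝔸∘𝕁≈id)
    , mk⇔ saturated⇒reduced⇒𝔸∘𝕁≈id 𝔸∘𝕁≈id⇒saturated⇒reduced
    , mk⇔ saturated⇒reduced⇒𝔸-surjective
          (𝔸∘𝕁≈id⇒saturated⇒reduced ∘ Sat.G-surjective⇒G∘F≈id)
    , mk⇔ (Sat.G∘F≈id⇒F-injective ∘ saturated⇒reduced⇒𝔸∘𝕁≈id)
          (𝔸∘𝕁≈id⇒saturated⇒reduced ∘ Sat.F-injective⇒G∘F≈id) )
  , ( mk⇔ (𝕁∘𝔸≈id⇒ʳˢ≈ʳ ∘ reduced⇒saturated⇒𝕁∘𝔸≈id) (𝕁∘𝔸≈id⇒reduced⇒saturated ∘ ʳˢ≈ʳ⇒𝕁∘𝔸≈id)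
    , mk⇔ reduced⇒saturated⇒𝕁∘𝔸≈id 𝕁∘𝔸≈id⇒reduced⇒saturated
    , mk⇔ reduced⇒saturated⇒𝕁-surjective
          (𝕁∘𝔸≈id⇒reduced⇒saturated ∘ Red.G-surjective⇒G∘F≈id)
    , mk⇔ (Red.G∘F≈id⇒F-injective ∘ reduced⇒saturated⇒𝕁∘𝔸≈id)
          (𝕁∘𝔸≈id⇒reduced⇒saturated ∘ Red.F-injective⇒G∘F≈id) )
  where open BasicTopologyGalois isBigA isBigJ
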